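{- Let $k\ge 1$ and let $\pi:\{1,\dots,k\}\to\{1,\dots,k\}$ be a permutation. Let $P$ be the 2-tuple matching determined by $\pi$, i.e. the ordered graph with vertex set $\{v_1<\dots<v_{3k}\}$ and edge set $\{v_jv_{k+i+2(\pi(j)-1)} : i\in\{1,2\},\ j\in\{1,\dots,k\}\}$. Then $ex_<(n,P)=O(n)$, where the implied constant depends only on $P$.
   Context: An ordered graph is a graph whose vertex set carries a fixed linear order. An ordered graph $G$ contains an ordered graph $P$ if there is an injective, order-preserving map $V(P)\to V(G)$ sending edges of $P$ to edges of $G$; otherwise $G$ avoids $P$. For an ordered graph $P$ with at least one edge, $ex_<(n,P)$ is the maximum number of edges of an ordered graph on $n$ vertices that avoids $P$. -}

module Defs where

open import Data.Nat using (ℕ; zero; suc; _+_; _*_; _≡ᵇ_)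
open import Data.Bool using (Bool; true; false; if_then_else_; _∧_; _∨_; T)
open import Data.Fin using (Fin; toℕ; _<_)
open import Data.Fin.Permutation using (Permutation′; _⟨$⟩ʳ_)
open import Data.List using (List; map; allFin)
open import Data.Nat.ListAction using (sum)
open import Data.Bool.ListAction using (any)
open import Data.Product using (Σ; _×_)

-- The (undirected, simple) edge set is given by a Boolean adjacency function
-- read only on pairs i < j (the "upper triangle"): {i,j} with i < j is an
-- edge iff adj i j ≡ true.
record OrderedGraph (n : ℕ) : Set where
  constructor mkOG
  field
    adj : Fin n → Fin n → Bool
open OrderedGraph public

IsEdge : ∀ {n} → OrderedGraph n → Fin n → Fin n → Set
IsEdge G i j = i < j × T (adj G i j)

edgeCount : ∀ {n} → OrderedGraph n → ℕ
edgeCount {n} G =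
  sum (map (λ i → sum (map (λ j → if (toℕ i Data.Nat.<ᵇ toℕ j) ∧ adj G i j then 1 else 0)
                              (allFin n)))
           (allFin n))

StrictlyIncreasing : ∀ {m n} → (Fin m → Fin n) → Set
StrictlyIncreasing {m} f = ∀ (i j : Fin m) → i < j → f i < f j

Contains : ∀ {m n} → OrderedGraph n → OrderedGraph m → Set
Contains {m} {n} G P =
  Σ (Fin m → Fin n) λ f → StrictlyIncreasing f ×
    (∀ (i j : Fin m) → IsEdge P i j → IsEdge G (f i) (f j))

Avoids : ∀ {m n} → OrderedGraph n → OrderedGraph m → Set
Avoids G P = Contains G P → Data.Empty.⊥
  where import Data.Empty

-- Vertices v_1 < ... < v_{3k} are Fin (3k) = {0,...,3k-1} (v_t ↦ t-1).
-- Edges v_j v_{k+i+2(π(j)-1)}, i ∈ {1,2}, j ∈ {1..k}; 0-based with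
-- j' = j-1 and π'(j') = π(j)-1 this is {j', k + 2π'(j')} and {j', k + 2π'(j') + 1}.
twoTupleMatching : (k : ℕ) → Permutation′ k → OrderedGraph (3 * k)
twoTupleMatching k π = mkOG λ a b →
  any (λ j → (toℕ a ≡ᵇ toℕ j) ∧
             ((toℕ b ≡ᵇ k + 2 * toℕ (π ⟨$⟩ʳ j)) ∨ (toℕ b ≡ᵇ k + 2 * toℕ (π ⟨$⟩ʳ j) + 1)))
      (allFin k)

module Submission where

open import Defs
open import Data.Nat using (ℕ; zero; suc; _+_; _*_; _∸_; _^_; _≤_; _<_; _≥_; z≤n; s≤s; z<s; s<s; s≤s⁻¹; _<ᵇ_; _≤ᵇ_; _≡ᵇ_; pred; _<?_; _/_; _%_)
open import Data.Nat.Properties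
open import Data.Nat.DivMod using (m≡m%n+[m/n]*n; m%n<n; m/n*n≤m)
open import Data.Nat.Solver using (module +-*-Solver)
open import Algebra.Properties.CommutativeSemigroup +-commutativeSemigroup using (interchange)
open import Data.Bool using (Bool; true; false; if_then_else_; _∧_; _∨_; not; T)
open import Data.Bool.Properties using (T-≡; T-∧; T-∨; ∧-assoc; ∧-identityʳ; ∨-identityʳ; ∧-conicalˡ; ∧-conicalʳ; ¬-not) renaming (_≟_ to _≟ᵇ_)
open import Data.Product using (Σ; _×_; _,_; proj₁; proj₂)
open import Data.Sum using (_⊎_; inj₁; inj₂)
open import Data.Empty using (⊥-elim)
open import Relation.Nullary using (¬_; Dec; yes; no; does)
open import Relation.Binary.PropositionalEquality
open import Function.Bundles using (Equivalence)
open import Data.Fin using (Fin; toℕ; fromℕ<)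
import Data.Fin as Fin
open import Data.Fin.Properties using (toℕ<n; toℕ-fromℕ<; fromℕ<-toℕ; fromℕ<-cong)
open import Data.Fin.Permutation using (Permutation′; _⟨$⟩ʳ_; _⟨$⟩ˡ_; inverseʳ; inverseˡ)
open import Data.Vec using (Vec; []; _∷_; head; tail; lookup; tabulate)
open import Data.Vec.Properties using (≡-dec; lookup∘tabulate)
open import Data.List using (map; allFin)
import Data.List as List
open import Data.List.Properties using (map-tabulate)
open import Data.Nat.ListAction using (sum)
open import Data.List.Relation.Unary.Any using (satisfied)
open import Data.List.Relation.Unary.Any.Properties using (any⁻)
open +-*-Solver

-- Encode an ordered graph G on [0, n) by its upper-triangular 0/1 matrix
-- (h r c = 1 iff r < c and rc is an edge).  A copy of P(π) in G is then a
-- Copy of the pattern in h: k increasing rows, row j with two ones, all columns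
-- right of all rows, column pairs ordered by π (Pattern.Embedding).
--
-- The bound is a Marcus–Tardos style compression (module Counting).  Scanning
-- the columns right of a block of t rows, a segment is cut whenever a row would
-- get a second one; segments hold ≤ k ones unless tall, and 2k tall segments
-- with equal active rows give a copy, so by pigeonhole over 2^t row sets they
-- are few (Segments).  Compressing the cuts into t × t blocks, heavy blocks are
-- few for the same reason and copies lift back (Compression), whence
--     ones(h) ≤ 2k² · ones(blocks) + N · K   with N ≈ n / t   (Step);
-- induction on n with t = 4 + 8k² gives ones(h) ≤ C·n.

true≢false : true ≢ false
true≢false ()

pred< : ∀ {y} → 0 < y → pred y < y
pred< {suc y} _ = n<1+n y

ind : Bool → ℕ
ind true  = 1
ind false = 0

ind≤1 : ∀ b → ind b ≤ 1
ind≤1 true  = ≤-refl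
ind≤1 false = z≤n

ind-∨ : ∀ a b → a ∧ b ≡ false → ind (a ∨ b) ≡ ind a + ind b
ind-∨ true  false _ = refl
ind-∨ false b     _ = refl

ind-split : ∀ a b → ind a ≡ ind (a ∧ b) + ind (a ∧ not b)
ind-split true  true  = refl
ind-split true  false = refl
ind-split false b     = refl

Sum : ℕ → (ℕ → ℕ) → ℕ
Sum zero    f = 0
Sum (suc n) f = f 0 + Sum n (λ i → f (suc i))

count : ℕ → (ℕ → Bool) → ℕ
count n p = Sum n (λ i → ind (p i))

Sum-ext : ∀ n {f g : ℕ → ℕ} → (∀ i → i < n → f i ≡ g i) → Sum n f ≡ Sum n g
Sum-ext zero    eq = refl
Sum-ext (suc n) eq = cong₂ _+_ (eq 0 z<s) (Sum-ext n (λ i i<n → eq (suc i) (s<s i<n)))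
Sum-mono : ∀ n {f g : ℕ → ℕ} → (∀ i → i < n → f i ≤ g i) → Sum n f ≤ Sum n g
Sum-mono zero    le = z≤n
Sum-mono (suc n) le = +-mono-≤ (le 0 z<s) (Sum-mono n (λ i i<n → le (suc i) (s<s i<n)))
Sum-+ : ∀ n (f g : ℕ → ℕ) → Sum n (λ i → f i + g i) ≡ Sum n f + Sum n g
Sum-+ zero    f g = refl
Sum-+ (suc n) f g = trans (cong (f 0 + g 0 +_) (Sum-+ n _ _)) (interchange (f 0) (g 0) _ _)
Sum-scale : ∀ n c (f : ℕ → ℕ) → Sum n (λ i → c * f i) ≡ c * Sum n f
Sum-scale zero    c f = sym (*-zeroʳ c)
Sum-scale (suc n) c f = trans (cong (c * f 0 +_) (Sum-scale n c _)) (sym (*-distribˡ-+ c (f 0) _))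
Sum-const : ∀ n c → Sum n (λ _ → c) ≡ n * c
Sum-const zero    c = refl
Sum-const (suc n) c = cong (c +_) (Sum-const n c)
Sum-zero : ∀ n {f : ℕ → ℕ} → (∀ i → i < n → f i ≡ 0) → Sum n f ≡ 0
Sum-zero n eq = trans (Sum-ext n eq) (trans (Sum-const n 0) (*-zeroʳ n))
Sum-bound : ∀ n c {f : ℕ → ℕ} → (∀ i → i < n → f i ≤ c) → Sum n f ≤ n * c
Sum-bound n c {f} le = subst (Sum n f ≤_) (Sum-const n c) (Sum-mono n le)
Sum-split : ∀ a b (f : ℕ → ℕ) → Sum (a + b) f ≡ Sum a f + Sum b (λ i → f (a + i))
Sum-split zero    b f = refl
Sum-split (suc a) b f = trans (cong (f 0 +_) (Sum-split a b (λ i → f (suc i)))) (sym (+-assoc (f 0) _ _))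
Sum-snoc : ∀ n (f : ℕ → ℕ) → Sum (suc n) f ≡ Sum n f + f n
Sum-snoc zero    f = +-comm (f 0) 0
Sum-snoc (suc n) f = trans (cong (f 0 +_) (Sum-snoc n (λ i → f (suc i)))) (sym (+-assoc (f 0) _ _))

Sum-prefix : ∀ {a b} (f : ℕ → ℕ) → a ≤ b → Sum a f ≤ Sum b f
Sum-prefix {a} {b} f a≤b = begin
    Sum a f                                 ≤⟨ m≤m+n _ _ ⟩
    Sum a f + Sum (b ∸ a) (λ i → f (a + i)) ≡⟨ sym (Sum-split a (b ∸ a) f) ⟩
    Sum (a + (b ∸ a)) f                     ≡⟨ cong (λ x → Sum x f) (m+[n∸m]≡n a≤b) ⟩
    Sum b f                                 ∎
  where open ≤-Reasoning
Sum-swap : ∀ n m (f : ℕ → ℕ → ℕ) → Sum n (λ i → Sum m (f i)) ≡ Sum m (λ j → Sum n (λ i → f i j))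
Sum-swap zero    m f = sym (Sum-zero m (λ _ _ → refl))
Sum-swap (suc n) m f = trans (cong (Sum m (f 0) +_) (Sum-swap n m (λ i → f (suc i)))) (sym (Sum-+ m (f 0) _))

Sum-blocks : ∀ N t (f : ℕ → ℕ) → Sum (N * t) f ≡ Sum N (λ I → Sum t (λ i → f (I * t + i)))
Sum-blocks zero    t f = refl
Sum-blocks (suc N) t f = trans (Sum-split t (N * t) f)
  (cong (Sum t f +_) (trans (Sum-blocks N t (λ i → f (t + i)))
     (Sum-ext N (λ I _ → Sum-ext t (λ i _ → cong f (sym (+-assoc t (I * t) i)))))))

count≤ : ∀ n p → count n p ≤ n
count≤ n p = subst (count n p ≤_) (*-identityʳ n) (Sum-bound n 1 (λ i _ → ind≤1 (p i)))
count-split : ∀ n (p q : ℕ → Bool) →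
  count n p ≡ count n (λ i → p i ∧ q i) + count n (λ i → p i ∧ not (q i))
count-split n p q = trans (Sum-ext n (λ i _ → ind-split (p i) (q i))) (Sum-+ n _ _)

threshold : ∀ m {c t} → c ≤ t → c ≤ m * ind (0 <ᵇ c) + t * ind (m ≤ᵇ c)
threshold m {zero}  _   = z≤n
threshold m {suc c} {t} c≤t = by-threshold (m ≤ᵇ suc c) refl
  where
    by-threshold : ∀ b → (m ≤ᵇ suc c) ≡ b → suc c ≤ m * 1 + t * ind (m ≤ᵇ suc c)
    by-threshold true  e = begin
      suc c                          ≤⟨ c≤t ⟩
      t                              ≡⟨ sym (*-identityʳ t) ⟩
      t * 1                          ≡⟨ cong (λ b → t * ind b) (sym e) ⟩
      t * ind (m ≤ᵇ suc c)           ≤⟨ m≤n+m _ _ ⟩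
      m * 1 + t * ind (m ≤ᵇ suc c)   ∎
      where open ≤-Reasoning
    by-threshold false e = begin
      suc c                          ≤⟨ <⇒≤ (≰⇒> (λ m≤c → subst T e (≤⇒≤ᵇ m≤c))) ⟩
      m                              ≡⟨ sym (*-identityʳ m) ⟩
      m * 1                          ≤⟨ m≤m+n _ _ ⟩
      m * 1 + t * ind (m ≤ᵇ suc c)   ∎
      where open ≤-Reasoning

anyBelow : ℕ → (ℕ → Bool) → Bool
anyBelow zero    p = false
anyBelow (suc n) p = p 0 ∨ anyBelow n (λ i → p (suc i))

anyBelow-true : ∀ n p → anyBelow n p ≡ true → Σ ℕ λ i → i < n × p i ≡ true
anyBelow-true (suc n) p e with p 0 in p0
... | true  = 0 , z<s , p0
... | false with anyBelow-true n (λ i → p (suc i)) e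
...   | i , i<n , pi = suc i , s<s i<n , pi

anyBelow-false : ∀ n p → anyBelow n p ≡ false → ∀ i → i < n → p i ≡ false
anyBelow-false (suc n) p e i i<n with p 0 in p0
anyBelow-false (suc n) p () i       i<n       | true
anyBelow-false (suc n) p e  zero    _         | false = p0
anyBelow-false (suc n) p e  (suc i) (s<s i<n) | false = anyBelow-false n _ e i i<n

Increasing : ℕ → (ℕ → ℕ) → Set
Increasing m g = ∀ i j → i < j → j < m → g i < g j

increasing-by-steps : ∀ m (g : ℕ → ℕ) → (∀ i → suc i < m → g i < g (suc i)) → Increasing m g
increasing-by-steps m g step i (suc j) i<1+j 1+j<m with m≤n⇒m<n∨m≡n (s≤s⁻¹ i<1+j)
... | inj₁ i<j  = <-trans (increasing-by-steps m g step i j i<j (<-trans (n<1+n j) 1+j<m)) (step j 1+j<m)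
... | inj₂ refl = step i 1+j<m
Increasing⇒≤ : ∀ {m g i j} → Increasing m g → i ≤ j → j < m → g i ≤ g j
Increasing⇒≤ {i = i} {j} inc i≤j j<m with m≤n⇒m<n∨m≡n i≤j
... | inj₁ i<j  = <⇒≤ (inc i j i<j j<m)
... | inj₂ refl = ≤-refl

record Selection (L m : ℕ) (p : ℕ → Bool) : Set where
  field
    pos     : ℕ → ℕ
    pos-inc : Increasing m pos
    pos<L   : ∀ i → i < m → pos i < L
    pos-ok  : ∀ i → i < m → p (pos i) ≡ true

select : ∀ L m p → m ≤ count L p → Selection L m p
select L zero p _ = record { pos = λ _ → 0 ; pos-inc = λ _ _ _ () ; pos<L = λ _ () ; pos-ok = λ _ () }
select zero (suc m) p ()
select (suc L) (suc m) p le with p 0 in p0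
... | true  = prepend (select L m (λ i → p (suc i)) (s≤s⁻¹ le))
  where
    prepend : Selection L m (λ i → p (suc i)) → Selection (suc L) (suc m) p
    prepend S = record { pos = pos′ ; pos-inc = inc ; pos<L = bounded ; pos-ok = ok }
      where
        open Selection S
        pos′ : ℕ → ℕ
        pos′ zero    = 0
        pos′ (suc i) = suc (pos i)
        inc : Increasing (suc m) pos′
        inc zero    (suc j) _         _         = z<s
        inc (suc i) (suc j) (s<s i<j) (s<s j<m) = s<s (pos-inc i j i<j j<m)
        bounded : ∀ i → i < suc m → pos′ i < suc L
        bounded zero    _         = z<s
        bounded (suc i) (s<s i<m) = s<s (pos<L i i<m)
        ok : ∀ i → i < suc m → p (pos′ i) ≡ true
        ok zero    _         = p0
        ok (suc i) (s<s i<m) = pos-ok i i<m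
... | false = shift (select L (suc m) (λ i → p (suc i)) le)
  where
    shift : Selection L (suc m) (λ i → p (suc i)) → Selection (suc L) (suc m) p
    shift S = record
      { pos     = λ i → suc (pos i)
      ; pos-inc = λ i j i<j j<m → s<s (pos-inc i j i<j j<m)
      ; pos<L   = λ i i<m → s<s (pos<L i i<m)
      ; pos-ok  = pos-ok
      }
      where open Selection S

sameCode : ∀ {t} → Vec Bool t → Vec Bool t → Bool
sameCode u v = does (≡-dec _≟ᵇ_ u v)

sameCode-sound : ∀ {t} (u v : Vec Bool t) → sameCode u v ≡ true → u ≡ v
sameCode-sound u v e with ≡-dec _≟ᵇ_ u v
... | yes u≡v = u≡v
sameCode-[] : ∀ (v : Vec Bool 0) → sameCode v [] ≡ true
sameCode-[] [] = refl

bit : Bool → Bool → Bool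
bit true  x = x
bit false x = not x

sameCode-∷ : ∀ {t} b (v : Vec Bool (suc t)) S → sameCode v (b ∷ S) ≡ bit b (head v) ∧ sameCode (tail v) S
sameCode-∷ true  (true  ∷ v) S = refl
sameCode-∷ true  (false ∷ v) S = refl
sameCode-∷ false (true  ∷ v) S = refl
sameCode-∷ false (false ∷ v) S = refl

codeOf : ∀ t → (ℕ → Bool) → Vec Bool t
codeOf t f = tabulate (λ o → f (toℕ o))
codeOf-injective : ∀ t (f g : ℕ → Bool) → codeOf t f ≡ codeOf t g → ∀ o → o < t → f o ≡ g o
codeOf-injective t f g eq o o<t = begin
    f o                                ≡⟨ cong f (sym (toℕ-fromℕ< o<t)) ⟩
    f (toℕ (fromℕ< o<t))               ≡⟨ sym (lookup∘tabulate _ (fromℕ< o<t)) ⟩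
    lookup (codeOf t f) (fromℕ< o<t)   ≡⟨ cong (λ v → lookup v (fromℕ< o<t)) eq ⟩
    lookup (codeOf t g) (fromℕ< o<t)   ≡⟨ lookup∘tabulate _ (fromℕ< o<t) ⟩
    g (toℕ (fromℕ< o<t))               ≡⟨ cong g (toℕ-fromℕ< o<t) ⟩
    g o                                ∎
  where open ≡-Reasoning

pigeonhole : ∀ t m D (p : ℕ → Bool) (code : ℕ → Vec Bool t) →
  (∀ S → count D (λ y → p y ∧ sameCode (code y) S) < m) → count D p ≤ 2 ^ t * m
pigeonhole zero m D p code few = begin
    count D p                                         ≡⟨ Sum-ext D (λ y _ → cong ind (sym (trivial y))) ⟩
    count D (λ y → p y ∧ sameCode (code y) [])        ≤⟨ <⇒≤ (few []) ⟩
    m                                                 ≡⟨ sym (+-identityʳ m) ⟩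
    2 ^ zero * m                                      ∎
  where
    open ≤-Reasoning
    trivial : ∀ y → p y ∧ sameCode (code y) [] ≡ p y
    trivial y = trans (cong (p y ∧_) (sameCode-[] (code y))) (∧-identityʳ (p y))
pigeonhole (suc t) m D p code few = begin
    count D p                                         ≡⟨ count-split D p (λ y → head (code y)) ⟩
    count D (half true) + count D (half false)        ≤⟨ +-mono-≤ (pigeonhole t m D _ (λ y → tail (code y)) (few-in true))
                                                                  (pigeonhole t m D _ (λ y → tail (code y)) (few-in false)) ⟩
    2 ^ t * m + 2 ^ t * m                             ≡⟨ solve 2 (λ a m → a :* m :+ a :* m := (con 2 :* a) :* m) refl (2 ^ t) m ⟩
    2 ^ suc t * m                                     ∎
  where
    open ≤-Reasoning
    half : Bool → ℕ → Bool
    half b y = p y ∧ bit b (head (code y))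
    regroup : ∀ b S y → p y ∧ sameCode (code y) (b ∷ S) ≡ half b y ∧ sameCode (tail (code y)) S
    regroup b S y = trans (cong (p y ∧_) (sameCode-∷ b (code y) S)) (sym (∧-assoc (p y) _ _))
    few-in : ∀ b S → count D (λ y → half b y ∧ sameCode (tail (code y)) S) < m
    few-in b S = subst (_< m) (Sum-ext D (λ y _ → cong ind (regroup b S y))) (few (b ∷ S))

extend : ∀ {m} → (Fin m → ℕ) → ℕ → ℕ
extend {m} g i with i <? m
... | yes i<m = g (fromℕ< i<m)
... | no  _   = 0
extend-fromℕ< : ∀ {m} (g : Fin m → ℕ) {i} (i<m : i < m) → extend g i ≡ g (fromℕ< i<m)
extend-fromℕ< {m} g {i} i<m with i <? m
... | yes _   = refl
... | no  i≮m = ⊥-elim (i≮m i<m)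

interleave : (ℕ → ℕ) → (ℕ → ℕ) → ℕ → ℕ
interleave A B zero          = A 0
interleave A B (suc zero)    = B 0
interleave A B (suc (suc w)) = interleave (λ p → A (suc p)) (λ p → B (suc p)) w

interleave-even : ∀ A B p → interleave A B (2 * p) ≡ A p
interleave-even A B zero    = refl
interleave-even A B (suc p) rewrite +-suc p (p + 0) = interleave-even (λ q → A (suc q)) (λ q → B (suc q)) p
interleave-odd : ∀ A B p → interleave A B (suc (2 * p)) ≡ B p
interleave-odd A B zero    = refl
interleave-odd A B (suc p) rewrite +-suc p (p + 0) = interleave-odd (λ q → A (suc q)) (λ q → B (suc q)) p

two-fewer : ∀ {w m} → suc (suc w) < 2 * suc m → w < 2 * m
two-fewer {w} {m} lt = s≤s⁻¹ (subst (suc (suc w) ≤_) (+-suc m (m + 0)) (s≤s⁻¹ lt))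

interleave-all : ∀ (P : ℕ → Set) m A B → (∀ p → p < m → P (A p)) → (∀ p → p < m → P (B p)) →
  ∀ w → w < 2 * m → P (interleave A B w)
interleave-all P (suc m) A B PA PB zero          _  = PA 0 z<s
interleave-all P (suc m) A B PA PB (suc zero)    _  = PB 0 z<s
interleave-all P (suc m) A B PA PB (suc (suc w)) lt =
  interleave-all P m (λ p → A (suc p)) (λ p → B (suc p))
    (λ p p<m → PA (suc p) (s<s p<m)) (λ p p<m → PB (suc p) (s<s p<m)) w (two-fewer lt)

interleave-step : ∀ m A B → (∀ p → p < m → A p < B p) → (∀ p → suc p < m → B p < A (suc p)) →
  ∀ w → suc w < 2 * m → interleave A B w < interleave A B (suc w)
interleave-step (suc m) A B AB BA zero          _  = AB 0 z<s
interleave-step (suc m) A B AB BA (suc zero)    lt = BA 0 (s<s (positive m (two-fewer lt)))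
  where
    positive : ∀ m → 0 < 2 * m → 0 < m
    positive (suc m) _ = z<s
interleave-step (suc m) A B AB BA (suc (suc w)) lt =
  interleave-step m (λ p → A (suc p)) (λ p → B (suc p))
    (λ p p<m → AB (suc p) (s<s p<m)) (λ p 1+p<m → BA (suc p) (s<s 1+p<m)) w (two-fewer lt)

append : ℕ → (ℕ → ℕ) → (ℕ → ℕ) → ℕ → ℕ
append m R S v = if v <ᵇ m then R v else S (v ∸ m)

append-left : ∀ m R S {v} → v < m → append m R S v ≡ R v
append-left m R S {v} v<m = cong (λ b → if b then R v else S (v ∸ m)) (Equivalence.to T-≡ (<⇒<ᵇ v<m))
append-right : ∀ m R S {v} → m ≤ v → append m R S v ≡ S (v ∸ m)
append-right m R S {v} m≤v = cong (λ b → if b then R v else S (v ∸ m))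
  (¬-not (λ v<ᵇm → <⇒≱ (<ᵇ⇒< v m (Equivalence.from T-≡ v<ᵇm)) m≤v))

append-inc : ∀ m l R S → Increasing m R → Increasing l S → (∀ i → i < m → R i < S 0) →
  Increasing (m + l) (append m R S)
append-inc m l R S incR incS R<S x y x<y y<m+l with x <? m | y <? m
... | yes x<m | yes y<m = subst₂ _<_ (sym (append-left m R S x<m)) (sym (append-left m R S y<m)) (incR x y x<y y<m)
... | yes x<m | no  y≮m = subst₂ _<_ (sym (append-left m R S x<m)) (sym (append-right m R S (≮⇒≥ y≮m)))
                            (<-≤-trans (R<S x x<m) (Increasing⇒≤ incS z≤n (offset< (≮⇒≥ y≮m))))
  where
    offset< : m ≤ y → y ∸ m < l
    offset< m≤y = subst (y ∸ m <_) (m+n∸m≡n m l) (∸-monoˡ-< y<m+l m≤y)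
... | no  x≮m | yes y<m = ⊥-elim (x≮m (<-trans x<y y<m))
... | no  x≮m | no  y≮m = subst₂ _<_ (sym (append-right m R S (≮⇒≥ x≮m))) (sym (append-right m R S (≮⇒≥ y≮m)))
                            (incS _ _ (∸-monoˡ-< x<y (≮⇒≥ x≮m)) (subst (y ∸ m <_) (m+n∸m≡n m l) (∸-monoˡ-< y<m+l (≮⇒≥ y≮m))))

2x+1<2y : ∀ {x y} → x < y → suc (2 * x) < 2 * y
2x+1<2y {x} {y} x<y = begin-strict
    suc (2 * x) <⟨ n<1+n _ ⟩
    2 + 2 * x   ≡⟨ sym (*-suc 2 x) ⟩
    2 * suc x   ≤⟨ *-monoʳ-≤ 2 x<y ⟩
    2 * y       ∎
  where open ≤-Reasoning

block< : ∀ {t I I' i i'} → I < I' → i < t → I * t + i < I' * t + i'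
block< {t} {I} {I'} {i} {i'} I<I' i<t = begin-strict
    I * t + i   <⟨ +-monoʳ-< (I * t) i<t ⟩
    I * t + t   ≡⟨ +-comm (I * t) t ⟩
    suc I * t   ≤⟨ *-monoˡ-≤ t I<I' ⟩
    I' * t      ≤⟨ m≤m+n _ _ ⟩
    I' * t + i' ∎
  where open ≤-Reasoning
below-next-block : ∀ {t I i} → i < t → I * t + i < t + I * t
below-next-block {t} {I} {i} i<t = subst (I * t + i <_) (+-comm (I * t) t) (+-monoʳ-< (I * t) i<t)

Matrix : Set
Matrix = ℕ → ℕ → Bool

UpperTriangular : ℕ → Matrix → Set
UpperTriangular n h = ∀ r c → h r c ≡ true → r < c × c < n

ones : ℕ → Matrix → ℕ
ones n h = Sum n (λ r → count n (h r))

adjMatrix : ∀ {n} → OrderedGraph n → Matrix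
adjMatrix {n} G r c with r <? n | c <? n
... | yes r<n | yes c<n = (r <ᵇ c) ∧ adj G (fromℕ< r<n) (fromℕ< c<n)
... | _       | _       = false

adjMatrix-true : ∀ {n} (G : OrderedGraph n) {r c} → adjMatrix G r c ≡ true →
  r < c × Σ (r < n) λ r<n → Σ (c < n) λ c<n → adj G (fromℕ< r<n) (fromℕ< c<n) ≡ true
adjMatrix-true {n} G {r} {c} e with r <? n | c <? n
... | yes r<n | yes c<n = <ᵇ⇒< r c (Equivalence.from T-≡ (∧-conicalˡ _ _ e)) , r<n , c<n , ∧-conicalʳ _ _ e

adjMatrix-upper : ∀ {n} (G : OrderedGraph n) → UpperTriangular n (adjMatrix G)
adjMatrix-upper G r c e with adjMatrix-true G e
... | r<c , _ , c<n , _ = r<c , c<n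

adjMatrix-fin : ∀ {n} (G : OrderedGraph n) (i j : Fin n) → adjMatrix G (toℕ i) (toℕ j) ≡ (toℕ i <ᵇ toℕ j) ∧ adj G i j
adjMatrix-fin {n} G i j with toℕ i <? n | toℕ j <? n
... | yes p | yes q = cong (λ (e : Fin n × Fin n) → (toℕ i <ᵇ toℕ j) ∧ adj G (proj₁ e) (proj₂ e))
                           (cong₂ _,_ (fromℕ<-toℕ i p) (fromℕ<-toℕ j q))
... | yes _ | no ¬q = ⊥-elim (¬q (toℕ<n j))
... | no ¬p | _     = ⊥-elim (¬p (toℕ<n i))

sum-tabulate : ∀ m (f : Fin m → ℕ) (g : ℕ → ℕ) → (∀ i → f i ≡ g (toℕ i)) → sum (List.tabulate f) ≡ Sum m g
sum-tabulate zero    f g eq = refl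
sum-tabulate (suc m) f g eq = cong₂ _+_ (eq Fin.zero)
  (sum-tabulate m (λ i → f (Fin.suc i)) (λ i → g (suc i)) (λ i → eq (Fin.suc i)))
sum-allFin : ∀ m (f : Fin m → ℕ) (g : ℕ → ℕ) → (∀ i → f i ≡ g (toℕ i)) → sum (map f (allFin m)) ≡ Sum m g
sum-allFin m f g eq = trans (cong sum (map-tabulate (λ x → x) f)) (sum-tabulate m f g eq)
if-ind : ∀ b → (if b then 1 else 0) ≡ ind b
if-ind true  = refl
if-ind false = refl

edgeCount-ones : ∀ {n} (G : OrderedGraph n) → edgeCount G ≡ ones n (adjMatrix G)
edgeCount-ones {n} G = sum-allFin n _ _ (λ i → sum-allFin n _ _ (λ j →
  trans (if-ind _) (cong ind (sym (adjMatrix-fin G i j)))))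

record Coarsening (t n : ℕ) : Set where
  field
    N     : ℕ
    n≤Nt  : n ≤ N * t
    Nt≤2n : N * t ≤ n + n
    N<n   : N < n

coarsen : ∀ t n → 4 ≤ t → t ≤ n → Coarsening t n
coarsen t@(suc _) n 4≤t t≤n = record { N = N ; n≤Nt = n≤Nt ; Nt≤2n = Nt≤2n ; N<n = N<n }
  where
    open ≤-Reasoning
    N : ℕ
    N = suc (n / t)
    n≤Nt : n ≤ N * t
    n≤Nt = begin
      n                 ≡⟨ m≡m%n+[m/n]*n n t ⟩
      n % t + n / t * t ≤⟨ +-monoˡ-≤ _ (<⇒≤ (m%n<n n t)) ⟩
      N * t             ∎
    Nt≤2n : N * t ≤ n + n
    Nt≤2n = +-mono-≤ t≤n (m/n*n≤m n t)
    N<n : N < n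
    N<n = begin-strict
      N      <⟨ m<m+n N {N} z<s ⟩
      N + N  ≤⟨ *-cancelˡ-≤ 2 (begin
                 2 * (N + N) ≡⟨ solve 1 (λ N → con 2 :* (N :+ N) := N :* con 4) refl N ⟩
                 N * 4       ≤⟨ *-monoʳ-≤ N 4≤t ⟩
                 N * t       ≤⟨ Nt≤2n ⟩
                 n + n       ≡⟨ solve 1 (λ n → n :+ n := con 2 :* n) refl n ⟩
                 2 * n       ∎) ⟩
      n      ∎

module Pattern (k : ℕ) (π : Permutation′ k) where

  -- Row j of the pattern owns the pattern columns 2·πn j and 2·πn j + 1.
  πn : Fin k → ℕ
  πn j = toℕ (π ⟨$⟩ʳ j)

  πn-inverse : ∀ {p} (p<k : p < k) → πn (π ⟨$⟩ˡ fromℕ< p<k) ≡ p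
  πn-inverse p<k = trans (cong toℕ (inverseʳ π)) (toℕ-fromℕ< p<k)

  -- A copy of the pattern in the matrix h: increasing rows, row j having ones
  -- in columns left j < right j, column pairs ordered by π, and every column at
  -- least sep (row j) for every row j (sep = suc: columns right of all rows).
  record Copy (h : Matrix) (sep : ℕ → ℕ) : Set where
    field
      row left right : Fin k → ℕ
      row-inc    : ∀ j j' → toℕ j < toℕ j' → row j < row j'
      left<right : ∀ j → left j < right j
      ordered    : ∀ j j' → πn j < πn j' → right j < left j'
      separated  : ∀ j j' → sep (row j) ≤ left j'
      edge-left  : ∀ j → h (row j) (left j) ≡ true
      edge-right : ∀ j → h (row j) (right j) ≡ true

  2πn+1<2k : ∀ j → suc (2 * πn j) < 2 * k
  2πn+1<2k j = 2x+1<2y (toℕ<n (π ⟨$⟩ʳ j))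

  2πn<2k : ∀ j → 2 * πn j < 2 * k
  2πn<2k j = <-trans (n<1+n _) (2πn+1<2k j)

  -- Row j keeps positions 2πn j, 2πn j + 1.
  grid-copy : (h : Matrix) (sep : ℕ → ℕ) (ρ : ℕ → ℕ) (col : ℕ → ℕ → ℕ) →
    Increasing k ρ →
    (∀ i i' p q → i < k → i' < k → p < q → q < 2 * k → col i p < col i' q) →
    (∀ i i' p → i < k → i' < k → p < 2 * k → sep (ρ i) ≤ col i' p) →
    (∀ i p → i < k → p < 2 * k → h (ρ i) (col i p) ≡ true) →
    Copy h sep
  grid-copy h sep ρ col ρ-inc col< sep≤ grid = record
    { row        = λ j → ρ (toℕ j)
    ; left       = λ j → col (toℕ j) (2 * πn j)
    ; right      = λ j → col (toℕ j) (suc (2 * πn j))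
    ; row-inc    = λ j j' j<j' → ρ-inc _ _ j<j' (toℕ<n j')
    ; left<right = λ j → col< _ _ _ _ (toℕ<n j) (toℕ<n j) (n<1+n _) (2πn+1<2k j)
    ; ordered    = λ j j' π<π' → col< _ _ _ _ (toℕ<n j) (toℕ<n j') (2x+1<2y π<π') (2πn<2k j')
    ; separated  = λ j j' → sep≤ _ _ _ (toℕ<n j) (toℕ<n j') (2πn<2k j')
    ; edge-left  = λ j → grid _ _ (toℕ<n j) (2πn<2k j)
    ; edge-right = λ j → grid _ _ (toℕ<n j) (2πn+1<2k j)
    }

  -- A copy in the matrix of G with sep = suc is a copy of P(π) in G: send the
  -- left vertices to the rows and the right vertices to the columns, the latter
  -- listed left to right by interleaving the left/right columns in π-order.
  module Embedding {n} (G : OrderedGraph n) (copy : Copy (adjMatrix G) suc) where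
    open Copy copy

    rowSeq leftSeq rightSeq colSeq vertex : ℕ → ℕ
    rowSeq   = extend row
    leftSeq  = extend (λ p → left (π ⟨$⟩ˡ p))
    rightSeq = extend (λ p → right (π ⟨$⟩ˡ p))
    colSeq   = interleave leftSeq rightSeq
    vertex   = append k rowSeq colSeq

    rowSeq-inc : Increasing k rowSeq
    rowSeq-inc i j i<j j<k = subst₂ _<_ (sym (extend-fromℕ< row (<-trans i<j j<k))) (sym (extend-fromℕ< row j<k))
      (row-inc _ _ (subst₂ _<_ (sym (toℕ-fromℕ< (<-trans i<j j<k))) (sym (toℕ-fromℕ< j<k)) i<j))
    colSeq-inc : Increasing (2 * k) colSeq
    colSeq-inc = increasing-by-steps (2 * k) colSeq (interleave-step k leftSeq rightSeq left<right′ right<left′)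
      where
        left<right′ : ∀ p → p < k → leftSeq p < rightSeq p
        left<right′ p p<k = subst₂ _<_ (sym (extend-fromℕ< _ p<k)) (sym (extend-fromℕ< _ p<k)) (left<right _)
        right<left′ : ∀ p → suc p < k → rightSeq p < leftSeq (suc p)
        right<left′ p 1+p<k = subst₂ _<_ (sym (extend-fromℕ< _ p<k)) (sym (extend-fromℕ< _ 1+p<k))
            (ordered _ _ (subst₂ _<_ (sym (πn-inverse p<k)) (sym (πn-inverse 1+p<k)) (n<1+n p)))
          where p<k = <-trans (n<1+n p) 1+p<k
    rows<cols : ∀ i → i < k → rowSeq i < colSeq 0
    rows<cols i i<k = subst₂ _<_ (sym (extend-fromℕ< row i<k)) (sym (extend-fromℕ< _ (≤-<-trans z≤n i<k)))
      (separated _ _)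
    vertex-inc : Increasing (3 * k) vertex
    vertex-inc = append-inc k (2 * k) rowSeq colSeq rowSeq-inc colSeq-inc rows<cols

    left<n : ∀ j → left j < n
    left<n j = proj₂ (adjMatrix-upper G _ _ (edge-left j))
    right<n : ∀ j → right j < n
    right<n j = proj₂ (adjMatrix-upper G _ _ (edge-right j))

    vertex<n : ∀ v → v < 3 * k → vertex v < n
    vertex<n v v<3k = by-side (v <? k)
      where
        by-side : Dec (v < k) → vertex v < n
        by-side (yes v<k) = subst (_< n) (sym (trans (append-left k rowSeq colSeq v<k) (extend-fromℕ< row v<k)))
                        (<-trans (separated _ _) (left<n (fromℕ< v<k)))
        by-side (no  v≮k) = subst (_< n) (sym (append-right k rowSeq colSeq (≮⇒≥ v≮k)))
                        (interleave-all (_< n) k leftSeq rightSeq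
                          (λ p p<k → subst (_< n) (sym (extend-fromℕ< _ p<k)) (left<n _))
                          (λ p p<k → subst (_< n) (sym (extend-fromℕ< _ p<k)) (right<n _))
                          (v ∸ k) (subst (v ∸ k <_) (m+n∸m≡n k (2 * k)) (∸-monoˡ-< v<3k (≮⇒≥ v≮k))))

    f : Fin (3 * k) → Fin n
    f v = fromℕ< (vertex<n (toℕ v) (toℕ<n v))
    f-inc : StrictlyIncreasing f
    f-inc x y x<y = subst₂ _<_ (sym (toℕ-fromℕ< _)) (sym (toℕ-fromℕ< _)) (vertex-inc _ _ x<y (toℕ<n y))

    vertex-row : ∀ j → vertex (toℕ j) ≡ row j
    vertex-row j = trans (append-left k rowSeq colSeq (toℕ<n j))
      (trans (extend-fromℕ< row (toℕ<n j)) (cong row (fromℕ<-toℕ j _)))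
    vertex-col : ∀ w → vertex (k + w) ≡ colSeq w
    vertex-col w = trans (append-right k rowSeq colSeq (m≤m+n k w)) (cong colSeq (m+n∸m≡n k w))
    π-cancel : ∀ j → π ⟨$⟩ˡ fromℕ< (toℕ<n (π ⟨$⟩ʳ j)) ≡ j
    π-cancel j = trans (cong (π ⟨$⟩ˡ_) (fromℕ<-toℕ _ _)) (inverseˡ π)
    vertex-left : ∀ j → vertex (k + 2 * πn j) ≡ left j
    vertex-left j = trans (vertex-col _) (trans (interleave-even leftSeq rightSeq (πn j))
      (trans (extend-fromℕ< _ (toℕ<n (π ⟨$⟩ʳ j))) (cong left (π-cancel j))))
    vertex-right : ∀ j → vertex (k + 2 * πn j + 1) ≡ right j
    vertex-right j = trans (cong vertex (trans (+-assoc k _ 1) (cong (k +_) (+-comm _ 1))))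
      (trans (vertex-col _) (trans (interleave-odd leftSeq rightSeq (πn j))
        (trans (extend-fromℕ< _ (toℕ<n (π ⟨$⟩ʳ j))) (cong right (π-cancel j)))))

    edge : ∀ (x y : Fin (3 * k)) {r c} → vertex (toℕ x) ≡ r → vertex (toℕ y) ≡ c →
      adjMatrix G r c ≡ true → T (adj G (f x) (f y))
    edge x y vx vy e with adjMatrix-true G e
    ... | _ , r<n , c<n , a = Equivalence.from T-≡
      (trans (cong₂ (adj G) (fromℕ<-cong _ _ vx _ r<n) (fromℕ<-cong _ _ vy _ c<n)) a)

    f-edge : ∀ (x y : Fin (3 * k)) → IsEdge (twoTupleMatching k π) x y → IsEdge G (f x) (f y)
    f-edge x y (x<y , e) with satisfied (any⁻ _ (allFin k) e)
    ... | j , pj with Equivalence.to T-∧ pj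
    ...   | x-is , y-is = f-inc x y x<y , by-column (Equivalence.to T-∨ y-is)
      where
        vx : vertex (toℕ x) ≡ row j
        vx = trans (cong vertex (≡ᵇ⇒≡ _ _ x-is)) (vertex-row j)
        by-column : T (toℕ y ≡ᵇ k + 2 * πn j) ⊎ T (toℕ y ≡ᵇ k + 2 * πn j + 1) → T (adj G (f x) (f y))
        by-column (inj₁ t) = edge x y vx (trans (cong vertex (≡ᵇ⇒≡ _ _ t)) (vertex-left j)) (edge-left j)
        by-column (inj₂ t) = edge x y vx (trans (cong vertex (≡ᵇ⇒≡ _ _ t)) (vertex-right j)) (edge-right j)

    contains : Contains G (twoTupleMatching k π)
    contains = f , f-inc , f-edge

module Counting (k : ℕ) (k≥1 : k ≥ 1) (π : Permutation′ k) where
  open Pattern k π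

  0<2k : 0 < 2 * k
  0<2k = <-≤-trans k≥1 (m≤m+n k (k + 0))

  -- Greedy segmentation of the columns right of row block I (rows I·t + i,
  -- i < t): a column is a cut when one of its ones falls in a row that already
  -- has a one in the current segment.
  module Segments (t : ℕ) (h : Matrix) (I : ℕ) where
    colStart : ℕ
    colStart = t + I * t

    entry : ℕ → ℕ → Bool
    entry d i = h (I * t + i) (colStart + d)

    mutual
      -- column colStart + d opens a new segment
      cut : ℕ → Bool
      cut zero    = false
      cut (suc d) = anyBelow t (λ i → active d i ∧ entry (suc d) i)

      -- row i has a one in the current segment, at or before column colStart + d
      active : ℕ → ℕ → Bool
      active zero    i = entry 0 i
      active (suc d) i = if cut (suc d) then entry (suc d) i else (active d i ∨ entry (suc d) i)

    weight activeCount : ℕ → ℕ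
    weight d      = count t (entry d)
    activeCount d = count t (active d)

    tallCut : ℕ → Bool
    tallCut zero    = false
    tallCut (suc d) = cut (suc d) ∧ (k ≤ᵇ activeCount d)

    active-cut : ∀ {d} → cut (suc d) ≡ true → ∀ i → active (suc d) i ≡ entry (suc d) i
    active-cut {d} e i = cong (λ b → if b then entry (suc d) i else (active d i ∨ entry (suc d) i)) e
    active-uncut : ∀ {d} → cut (suc d) ≡ false → ∀ i → active (suc d) i ≡ active d i ∨ entry (suc d) i
    active-uncut {d} e i = cong (λ b → if b then entry (suc d) i else (active d i ∨ entry (suc d) i)) e

    -- A column either adds its ones to rows not yet active, or closes the
    -- current segment, which carries ≤ k ones unless it is tall (then ≤ t).
    weight-step : ∀ d → activeCount d + weight (suc d) ≤
      k * ind (cut (suc d)) + t * ind (tallCut (suc d)) + activeCount (suc d)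
    weight-step d = by-cut (cut (suc d)) refl
      where
        open ≤-Reasoning
        by-cut : ∀ b → cut (suc d) ≡ b → activeCount d + weight (suc d) ≤
          k * ind (cut (suc d)) + t * ind (tallCut (suc d)) + activeCount (suc d)
        by-cut true e = begin
            activeCount d + weight (suc d)
              ≤⟨ +-monoˡ-≤ _ (threshold k (count≤ t (active d))) ⟩
            k * ind (0 <ᵇ activeCount d) + t * ind (k ≤ᵇ activeCount d) + weight (suc d)
              ≤⟨ +-monoˡ-≤ _ (+-monoˡ-≤ _ (*-monoʳ-≤ k (ind≤1 _))) ⟩
            k * 1 + t * ind (k ≤ᵇ activeCount d) + weight (suc d)
              ≡⟨ cong₂ _+_ (cong₂ _+_ (cong (λ b → k * ind b) (sym e)) (cong (λ b → t * ind (b ∧ (k ≤ᵇ activeCount d))) (sym e)))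
                           (Sum-ext t (λ i _ → cong ind (sym (active-cut e i)))) ⟩
            k * ind (cut (suc d)) + t * ind (tallCut (suc d)) + activeCount (suc d) ∎
        by-cut false e = begin
            activeCount d + weight (suc d)                          ≡⟨ sym (Sum-+ t _ _) ⟩
            Sum t (λ i → ind (active d i) + ind (entry (suc d) i))  ≡⟨ Sum-ext t disjoint ⟩
            activeCount (suc d)
              ≡⟨ sym (cong₂ (λ x y → x + y + activeCount (suc d)) (trans (cong (λ b → k * ind b) e) (*-zeroʳ k))
                                                                   (trans (cong (λ b → t * ind (b ∧ (k ≤ᵇ activeCount d))) e) (*-zeroʳ t))) ⟩
            k * ind (cut (suc d)) + t * ind (tallCut (suc d)) + activeCount (suc d) ∎
          where
            disjoint : ∀ i → i < t → ind (active d i) + ind (entry (suc d) i) ≡ ind (active (suc d) i)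
            disjoint i i<t = sym (trans (cong ind (active-uncut e i))
              (ind-∨ (active d i) (entry (suc d) i) (anyBelow-false t (λ i → active d i ∧ entry (suc d) i) e i i<t)))

    segment-invariant : ∀ d → Sum (suc d) weight ≤ k * count (suc d) cut + t * count (suc d) tallCut + activeCount d
    segment-invariant zero    = ≤-trans (≤-reflexive (+-identityʳ (weight 0))) (m≤n+m _ _)
    segment-invariant (suc d) = begin
        Sum (suc (suc d)) weight                                  ≡⟨ Sum-snoc (suc d) weight ⟩
        Sum (suc d) weight + weight (suc d)                       ≤⟨ +-monoˡ-≤ _ (segment-invariant d) ⟩
        k * cs + t * ts + activeCount d + weight (suc d)          ≡⟨ +-assoc (k * cs + t * ts) _ _ ⟩
        k * cs + t * ts + (activeCount d + weight (suc d))        ≤⟨ +-monoʳ-≤ (k * cs + t * ts) (weight-step d) ⟩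
        k * cs + t * ts + (k * c + t * τ + activeCount (suc d))
          ≡⟨ solve 7 (λ k t cs ts c τ a → k :* cs :+ t :* ts :+ (k :* c :+ t :* τ :+ a) := k :* (cs :+ c) :+ t :* (ts :+ τ) :+ a)
                   refl k t cs ts c τ (activeCount (suc d)) ⟩
        k * (cs + c) + t * (ts + τ) + activeCount (suc d)
          ≡⟨ cong₂ (λ x y → k * x + t * y + activeCount (suc d))
                   (sym (Sum-snoc (suc d) (λ y → ind (cut y)))) (sym (Sum-snoc (suc d) (λ y → ind (tallCut y)))) ⟩
        k * count (suc (suc d)) cut + t * count (suc (suc d)) tallCut + activeCount (suc d) ∎
      where
        open ≤-Reasoning
        cs ts c τ : ℕ
        cs = count (suc d) cut
        ts = count (suc d) tallCut
        c  = ind (cut (suc d))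
        τ  = ind (tallCut (suc d))

    segment-bound : ∀ D → Sum D weight ≤ k * count D cut + t * count D tallCut + t
    segment-bound zero    = z≤n
    segment-bound (suc d) = ≤-trans (segment-invariant d) (+-monoʳ-≤ _ (count≤ t (active d)))

    cut-witness : ∀ d → cut (suc d) ≡ true → Σ ℕ λ i → i < t × active d i ≡ true × entry (suc d) i ≡ true
    cut-witness d e with anyBelow-true t (λ i → active d i ∧ entry (suc d) i) e
    ... | i , i<t , both = i , i<t , ∧-conicalˡ _ _ both , ∧-conicalʳ _ _ both

    lastOne : ℕ → ℕ → ℕ
    lastOne zero    i = 0
    lastOne (suc d) i = if entry (suc d) i then suc d else lastOne d i

    record InSegment (d i c : ℕ) : Set where
      field
        c≤d   : c ≤ d
        hit   : entry c i ≡ true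
        uncut : ∀ z → c < z → z ≤ d → cut z ≡ false

    lastOne-spec : ∀ d i → active d i ≡ true → InSegment d i (lastOne d i)
    lastOne-spec zero    i e = record { c≤d = z≤n ; hit = e ; uncut = λ z 0<z z≤0 → ⊥-elim (<⇒≱ 0<z z≤0) }
    lastOne-spec (suc d) i e = by-entry (entry (suc d) i) refl
      where
        by-entry : ∀ b → entry (suc d) i ≡ b → InSegment (suc d) i (lastOne (suc d) i)
        by-entry true  eb = subst (InSegment (suc d) i) (sym (cong (λ b → if b then suc d else lastOne d i) eb))
          record { c≤d = ≤-refl ; hit = eb ; uncut = λ z d<z z≤d → ⊥-elim (<⇒≱ d<z z≤d) }
        by-entry false eb = subst (InSegment (suc d) i) (sym (cong (λ b → if b then suc d else lastOne d i) eb))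
          record { c≤d = m≤n⇒m≤1+n c≤d ; hit = hit ; uncut = uncut′ }
          where
            -- a cut at d + 1 would make row i inactive there
            no-cut : cut (suc d) ≡ false
            no-cut = ¬-not (λ ec → true≢false (trans (sym e) (trans (active-cut ec i) eb)))
            active-before : active d i ≡ true
            active-before = trans (sym (∨-identityʳ (active d i)))
              (trans (cong (active d i ∨_) (sym eb)) (trans (sym (active-uncut no-cut i)) e))
            open InSegment (lastOne-spec d i active-before)
            uncut′ : ∀ z → lastOne d i < z → z ≤ suc d → cut z ≡ false
            uncut′ z lt z≤1+d with m≤n⇒m<n∨m≡n z≤1+d
            ... | inj₁ z<1+d = uncut z lt (s≤s⁻¹ z<1+d)
            ... | inj₂ refl  = no-cut

    tallCut-inv : ∀ y → tallCut y ≡ true → cut y ≡ true × k ≤ activeCount (pred y) × 0 < y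
    tallCut-inv zero    ()
    tallCut-inv (suc d) e = ∧-conicalˡ _ _ e , ≤ᵇ⇒≤ k _ (Equivalence.from T-≡ (∧-conicalʳ _ _ e)) , z<s

    code : ℕ → Vec Bool t
    code y = codeOf t (active (pred y))

    -- 2k tall cuts closing segments with the same active rows give a copy: take
    -- k common active rows and their last ones in each of the 2k segments.
    tall-copy : ∀ D S → 2 * k ≤ count D (λ y → tallCut y ∧ sameCode (code y) S) → Copy h suc
    tall-copy D S many = grid-copy h suc ρ col ρ-inc col< sep≤ (λ i p i<k p<2k → InSegment.hit (spec i p i<k p<2k))
      where
        module Y = Selection (select D (2 * k) _ many)
        tall : ∀ p → p < 2 * k → tallCut (Y.pos p) ≡ true
        tall p p<2k = ∧-conicalˡ _ _ (Y.pos-ok p p<2k)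
        coded : ∀ p → p < 2 * k → code (Y.pos p) ≡ S
        coded p p<2k = sameCode-sound _ _ (∧-conicalʳ _ _ (Y.pos-ok p p<2k))
        d₀ : ℕ
        d₀ = pred (Y.pos 0)
        module R = Selection (select t k (active d₀) (proj₁ (proj₂ (tallCut-inv (Y.pos 0) (tall 0 0<2k)))))
        common : ∀ i p → i < k → p < 2 * k → active (pred (Y.pos p)) (R.pos i) ≡ true
        common i p i<k p<2k = trans (codeOf-injective t (active (pred (Y.pos p))) (active d₀)
          (trans (coded p p<2k) (sym (coded 0 0<2k))) (R.pos i) (R.pos<L i i<k)) (R.pos-ok i i<k)
        spec : ∀ i p → i < k → p < 2 * k → InSegment (pred (Y.pos p)) (R.pos i) (lastOne (pred (Y.pos p)) (R.pos i))
        spec i p i<k p<2k = lastOne-spec _ _ (common i p i<k p<2k)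
        ρ : ℕ → ℕ
        ρ i = I * t + R.pos i
        col : ℕ → ℕ → ℕ
        col i p = colStart + lastOne (pred (Y.pos p)) (R.pos i)
        ρ-inc : Increasing k ρ
        ρ-inc i j i<j j<k = +-monoʳ-< (I * t) (R.pos-inc i j i<j j<k)
        col< : ∀ i i' p q → i < k → i' < k → p < q → q < 2 * k → col i p < col i' q
        col< i i' p q i<k i'<k p<q q<2k = +-monoʳ-< colStart (begin-strict
            lastOne (pred (Y.pos p)) (R.pos i)   ≤⟨ InSegment.c≤d (spec i p i<k p<2k) ⟩
            pred (Y.pos p)                       <⟨ pred< (proj₂ (proj₂ tall-p)) ⟩
            Y.pos p                              ≤⟨ ≮⇒≥ crossing ⟩
            lastOne (pred (Y.pos q)) (R.pos i')  ∎)
          where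
            open ≤-Reasoning
            p<2k = <-trans p<q q<2k
            tall-p = tallCut-inv (Y.pos p) (tall p p<2k)
            -- the cut Y.pos p cannot lie inside the segment of the q-th last one
            crossing : ¬ (lastOne (pred (Y.pos q)) (R.pos i') < Y.pos p)
            crossing lt = true≢false (trans (sym (proj₁ tall-p))
              (InSegment.uncut (spec i' q i'<k q<2k) (Y.pos p) lt (<⇒≤pred (Y.pos-inc p q p<q q<2k))))
        sep≤ : ∀ i i' p → i < k → i' < k → p < 2 * k → suc (ρ i) ≤ col i' p
        sep≤ i _ _ i<k _ _ = ≤-trans (below-next-block {I = I} (R.pos<L i i<k)) (m≤m+n colStart _)

    tall-bound : ¬ Copy h suc → ∀ D → count D tallCut ≤ 2 ^ t * (2 * k)
    tall-bound avoid D = pigeonhole t (2 * k) D tallCut code (λ S → ≰⇒> (λ many → avoid (tall-copy D S many)))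

  -- Compressing h: first to the cut matrix (row blocks × columns), then to
  -- t × t blocks of the cut matrix.  Copies lift back in both steps.
  module Compression (t : ℕ) (h : Matrix) where
    module Seg (I : ℕ) = Segments t h I

    cuts : Matrix
    cuts I c = (Seg.colStart I ≤ᵇ c) ∧ Seg.cut I (c ∸ Seg.colStart I)

    cuts-inv : ∀ {I c} → cuts I c ≡ true → Seg.colStart I ≤ c × Seg.cut I (c ∸ Seg.colStart I) ≡ true
    cuts-inv {I} {c} e = ≤ᵇ⇒≤ (Seg.colStart I) c (Equivalence.from T-≡ (∧-conicalˡ _ _ e)) , ∧-conicalʳ _ _ e
    cuts-shift : ∀ I d → cuts I (Seg.colStart I + d) ≡ Seg.cut I d
    cuts-shift I d = cong₂ _∧_ (Equivalence.to T-≡ (≤⇒≤ᵇ (m≤m+n (Seg.colStart I) d))) (cong (Seg.cut I) (m+n∸m≡n (Seg.colStart I) d))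

    record Bridge (I x y : ℕ) : Set where
      field
        i c   : ℕ
        i<t   : i < t
        x≤c   : x ≤ c
        c<y   : c < y
        hit-c : Seg.entry I c i ≡ true
        hit-y : Seg.entry I y i ≡ true

    bridge : ∀ I x y → x < y → Seg.cut I x ≡ true → Seg.cut I y ≡ true → Bridge I x y
    bridge I x (suc d) x<y cut-x cut-y = from-witness (S.cut-witness d cut-y)
      where
        module S = Segments t h I
        from-witness : (Σ ℕ λ i → i < t × S.active d i ≡ true × S.entry (suc d) i ≡ true) → Bridge I x (suc d)
        from-witness (i , i<t , act , hit-y) = record
          { i = i ; c = S.lastOne d i ; i<t = i<t ; x≤c = ≮⇒≥ before ; c<y = s≤s c≤d ; hit-c = hit ; hit-y = hit-y }
          where
            open S.InSegment (S.lastOne-spec d i act)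
            before : ¬ (S.lastOne d i < x)
            before lt = true≢false (trans (sym cut-x) (uncut x lt (s≤s⁻¹ x<y)))

    -- a copy in the cut matrix lifts to h: replace each pair of cuts by a bridge
    lift-cuts : Copy cuts Seg.colStart → Copy h suc
    lift-cuts copy = record
      { row        = λ j → old.row j * t + B.i j
      ; left       = left′
      ; right      = old.right
      ; row-inc    = λ j j' j<j' → block< {I = old.row j} {old.row j'} (old.row-inc j j' j<j') (B.i<t j)
      ; left<right = λ j → subst (left′ j <_) (back-right j) (+-monoʳ-< (colStart j) (B.c<y j))
      ; ordered    = λ j j' π<π' → <-≤-trans (old.ordered j j' π<π') (left≤ j')
      ; separated  = λ j j' → ≤-trans (below-next-block {I = old.row j} (B.i<t j)) (≤-trans (old.separated j j') (left≤ j'))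
      ; edge-left  = B.hit-c
      ; edge-right = λ j → subst (λ c → h (old.row j * t + B.i j) c ≡ true) (back-right j) (B.hit-y j)
      }
      where
        module old = Copy copy
        colStart : Fin k → ℕ
        colStart j = Seg.colStart (old.row j)
        bridges : ∀ j → Bridge (old.row j) (old.left j ∸ colStart j) (old.right j ∸ colStart j)
        bridges j = bridge (old.row j) _ _ (∸-monoˡ-< (old.left<right j) (proj₁ (cuts-inv (old.edge-left j))))
          (proj₂ (cuts-inv (old.edge-left j))) (proj₂ (cuts-inv (old.edge-right j)))
        module B (j : Fin k) = Bridge (bridges j)
        left′ : Fin k → ℕ
        left′ j = colStart j + B.c j
        back-right : ∀ j → colStart j + (old.right j ∸ colStart j) ≡ old.right j
        back-right j = m+[n∸m]≡n (proj₁ (cuts-inv (old.edge-right j)))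
        left≤ : ∀ j → old.left j ≤ left′ j
        left≤ j = subst (_≤ left′ j) (m+[n∸m]≡n (proj₁ (cuts-inv (old.edge-left j)))) (+-monoʳ-≤ (colStart j) (B.x≤c j))

    -- cut columns carry a one of h, hence lie inside [0, n)
    cut⇒column< : ∀ {n} → UpperTriangular n h → ∀ {I c} → cuts I c ≡ true → c < n
    cut⇒column< {n} upper {I} {c} e = subst (_< n) (m+[n∸m]≡n (proj₁ (cuts-inv e))) (one-at (c ∸ Seg.colStart I) (proj₂ (cuts-inv e)))
      where
        one-at : ∀ y → Seg.cut I y ≡ true → Seg.colStart I + y < n
        one-at (suc d) cut-y with Seg.cut-witness I d cut-y
        ... | _ , _ , _ , hit = proj₂ (upper _ _ hit)

    blockWeight : ℕ → ℕ → ℕ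
    blockWeight I J = count t (λ o → cuts I (J * t + o))

    blocks heavy : Matrix
    blocks I J = 0 <ᵇ blockWeight I J
    heavy  I J = 2 * k ≤ᵇ blockWeight I J

    block-witness : ∀ {I J} → blocks I J ≡ true → Σ ℕ λ o → o < t × cuts I (J * t + o) ≡ true
    block-witness {I} {J} e = S.pos 0 , S.pos<L 0 z<s , S.pos-ok 0 z<s
      where module S = Selection (select t 1 (λ o → cuts I (J * t + o)) (<ᵇ⇒< 0 _ (Equivalence.from T-≡ e)))

    -- a copy in the block matrix lifts to the cut matrix: pick a cut in each block
    lift-blocks : Copy blocks suc → Copy cuts Seg.colStart
    lift-blocks copy = record
      { row        = old.row
      ; left       = λ j → old.left j * t + proj₁ (at-left j)
      ; right      = λ j → old.right j * t + proj₁ (at-right j)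
      ; row-inc    = old.row-inc
      ; left<right = λ j → block< {I = old.left j} {old.right j} (old.left<right j) (proj₁ (proj₂ (at-left j)))
      ; ordered    = λ j j' π<π' → block< {I = old.right j} {old.left j'} (old.ordered j j' π<π') (proj₁ (proj₂ (at-right j)))
      ; separated  = λ j j' → ≤-trans (*-monoˡ-≤ t (old.separated j j')) (m≤m+n _ _)
      ; edge-left  = λ j → proj₂ (proj₂ (at-left j))
      ; edge-right = λ j → proj₂ (proj₂ (at-right j))
      }
      where
        module old = Copy copy
        at-left : ∀ j → Σ ℕ λ o → o < t × cuts (old.row j) (old.left j * t + o) ≡ true
        at-left j = block-witness {old.row j} {old.left j} (old.edge-left j)
        at-right : ∀ j → Σ ℕ λ o → o < t × cuts (old.row j) (old.right j * t + o) ≡ true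
        at-right j = block-witness {old.row j} {old.right j} (old.edge-right j)

    blocks-upper : ∀ {n N} → UpperTriangular n h → n ≤ N * t → UpperTriangular N blocks
    blocks-upper {n} {N} upper n≤Nt I J e with block-witness {I} {J} e
    ... | o , o<t , cut-o = ≰⇒> J≰I , *-cancelʳ-< t J N (≤-<-trans (m≤m+n (J * t) o) (<-≤-trans (cut⇒column< upper cut-o) n≤Nt))
      where
        J≰I : ¬ (J ≤ I)
        J≰I J≤I = <⇒≱ (<-≤-trans (below-next-block {t} {J} o<t) (*-monoˡ-≤ t (s≤s J≤I))) (proj₁ (cuts-inv cut-o))

    blockCode : ℕ → ℕ → Vec Bool t
    blockCode J I = codeOf t (λ o → cuts I (J * t + o))

    -- k heavy blocks in one column block with the same cut pattern give a copy
    -- in the cut matrix: k rows sharing 2k cut columns.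
    heavy-copy : ∀ N J S → k ≤ count N (λ I → heavy I J ∧ sameCode (blockCode J I) S) → Copy cuts Seg.colStart
    heavy-copy N J S many = grid-copy cuts Seg.colStart R.pos (λ _ p → J * t + O.pos p) R.pos-inc col< sep≤ grid
      where
        module R = Selection (select N k _ many)
        coded : ∀ i → i < k → blockCode J (R.pos i) ≡ S
        coded i i<k = sameCode-sound _ _ (∧-conicalʳ _ _ (R.pos-ok i i<k))
        I₀ : ℕ
        I₀ = R.pos 0
        module O = Selection (select t (2 * k) (λ o → cuts I₀ (J * t + o))
          (≤ᵇ⇒≤ (2 * k) _ (Equivalence.from T-≡ (∧-conicalˡ _ _ (R.pos-ok 0 k≥1)))))
        grid : ∀ i p → i < k → p < 2 * k → cuts (R.pos i) (J * t + O.pos p) ≡ true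
        grid i p i<k p<2k = trans (codeOf-injective t (λ o → cuts (R.pos i) (J * t + o)) (λ o → cuts I₀ (J * t + o))
          (trans (coded i i<k) (sym (coded 0 k≥1))) (O.pos p) (O.pos<L p p<2k)) (O.pos-ok p p<2k)
        col< : ∀ i i' p q → i < k → i' < k → p < q → q < 2 * k → J * t + O.pos p < J * t + O.pos q
        col< _ _ p q _ _ p<q q<2k = +-monoʳ-< (J * t) (O.pos-inc p q p<q q<2k)
        sep≤ : ∀ i i' p → i < k → i' < k → p < 2 * k → Seg.colStart (R.pos i) ≤ J * t + O.pos p
        sep≤ i _ p i<k _ p<2k = proj₁ (cuts-inv (grid i p i<k p<2k))

    heavy-bound : ¬ Copy h suc → ∀ N J → count N (λ I → heavy I J) ≤ 2 ^ t * k
    heavy-bound avoid N J = pigeonhole t k N (λ I → heavy I J) (blockCode J)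
      (λ S → ≰⇒> (λ many → avoid (lift-cuts (heavy-copy N J S many))))

  stepConstant : ℕ → ℕ
  stepConstant t = t * t + t * (2 ^ t * (2 * k)) + t + k * (t * (2 ^ t * k))

  module Step (t : ℕ) (h : Matrix) (n N : ℕ) (upper : UpperTriangular n h) (avoid : ¬ Copy h suc)
              (n≤Nt : n ≤ N * t) where
    open Compression t h

    colWeight : ℕ → ℕ → ℕ
    colWeight I c = count t (λ i → h (I * t + i) c)

    -- left of Seg.colStart I only the block's own t × t square can carry ones
    square-bound : ∀ I → Sum (Seg.colStart I) (colWeight I) ≤ t * t
    square-bound I = begin
        Sum (t + I * t) (colWeight I)                                      ≡⟨ cong (λ x → Sum x (colWeight I)) (+-comm t (I * t)) ⟩
        Sum (I * t + t) (colWeight I)                                      ≡⟨ Sum-split (I * t) t (colWeight I) ⟩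
        Sum (I * t) (colWeight I) + Sum t (λ o → colWeight I (I * t + o))  ≡⟨ cong (_+ Sum t (λ o → colWeight I (I * t + o)))
                                                                                  (Sum-zero (I * t) (λ c c<It → Sum-zero t (λ i _ → below-diagonal i c c<It))) ⟩
        Sum t (λ o → colWeight I (I * t + o))                              ≤⟨ Sum-bound t t (λ o _ → count≤ t _) ⟩
        t * t                                                              ∎
      where
        open ≤-Reasoning
        below-diagonal : ∀ i c → c < I * t → ind (h (I * t + i) c) ≡ 0
        below-diagonal i c c<It with h (I * t + i) c in e
        ... | true  = ⊥-elim (<-irrefl refl (<-trans (≤-<-trans (m≤m+n (I * t) i) (proj₁ (upper _ _ e))) c<It))
        ... | false = refl

    cutRow : ℕ → ℕ
    cutRow I = count (N * t) (cuts I)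

    row-block-bound : ∀ I → I < N → Sum t (λ i → count n (h (I * t + i))) ≤
      t * t + t * (2 ^ t * (2 * k)) + t + k * cutRow I
    row-block-bound I I<N = begin
        Sum t (λ i → count n (h (I * t + i)))             ≡⟨ Sum-swap t n (λ i c → ind (h (I * t + i) c)) ⟩
        Sum n (colWeight I)                               ≤⟨ Sum-prefix (colWeight I) n≤Nt ⟩
        Sum (N * t) (colWeight I)                         ≡⟨ cong (λ x → Sum x (colWeight I)) (sym split) ⟩
        Sum (S.colStart + D) (colWeight I)                ≡⟨ Sum-split S.colStart D (colWeight I) ⟩
        Sum S.colStart (colWeight I) + Sum D S.weight     ≤⟨ +-mono-≤ (square-bound I) (S.segment-bound D) ⟩
        t * t + (k * count D S.cut + t * count D S.tallCut + t)
          ≤⟨ +-monoʳ-≤ (t * t) (+-monoˡ-≤ t (+-mono-≤ (*-monoʳ-≤ k cuts≤) (*-monoʳ-≤ t (S.tall-bound avoid D)))) ⟩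
        t * t + (k * cutRow I + t * (2 ^ t * (2 * k)) + t)
          ≡⟨ solve 4 (λ a b c d → a :+ (d :+ b :+ c) := a :+ b :+ c :+ d) refl (t * t) (t * (2 ^ t * (2 * k))) t (k * cutRow I) ⟩
        t * t + t * (2 ^ t * (2 * k)) + t + k * cutRow I  ∎
      where
        open ≤-Reasoning
        module S = Segments t h I
        D : ℕ
        D = N * t ∸ S.colStart
        split : S.colStart + D ≡ N * t
        split = m+[n∸m]≡n (*-monoˡ-≤ t I<N)
        cuts≤ : count D S.cut ≤ cutRow I
        cuts≤ = begin
          count D S.cut                                                ≡⟨ Sum-ext D (λ d _ → cong ind (sym (cuts-shift I d))) ⟩
          Sum D (λ d → ind (cuts I (S.colStart + d)))                  ≤⟨ m≤n+m _ _ ⟩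
          count S.colStart (cuts I) + Sum D (λ d → ind (cuts I (S.colStart + d))) ≡⟨ sym (Sum-split S.colStart D (λ c → ind (cuts I c))) ⟩
          count (S.colStart + D) (cuts I)                              ≡⟨ cong (λ x → count x (cuts I)) split ⟩
          cutRow I                                                     ∎

    -- each column block holds < 2k cuts of row block I unless heavy (then ≤ t)
    cut-row-bound : ∀ I → cutRow I ≤ 2 * k * count N (blocks I) + t * count N (λ J → heavy I J)
    cut-row-bound I = begin
        cutRow I                                                         ≡⟨ Sum-blocks N t (λ c → ind (cuts I c)) ⟩
        Sum N (blockWeight I)                                            ≤⟨ Sum-mono N (λ J _ → threshold (2 * k) (count≤ t _)) ⟩
        Sum N (λ J → 2 * k * ind (blocks I J) + t * ind (heavy I J))     ≡⟨ Sum-+ N _ _ ⟩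
        Sum N (λ J → 2 * k * ind (blocks I J)) + Sum N (λ J → t * ind (heavy I J))
                                                                         ≡⟨ cong₂ _+_ (Sum-scale N (2 * k) _) (Sum-scale N t _) ⟩
        2 * k * count N (blocks I) + t * count N (λ J → heavy I J)       ∎
      where open ≤-Reasoning

    step-bound : ones n h ≤ k * (2 * k) * ones N blocks + N * stepConstant t
    step-bound = begin
        ones n h                                                         ≤⟨ Sum-prefix _ n≤Nt ⟩
        Sum (N * t) (λ r → count n (h r))                                ≡⟨ Sum-blocks N t _ ⟩
        Sum N (λ I → Sum t (λ i → count n (h (I * t + i))))              ≤⟨ Sum-mono N row-block-bound ⟩
        Sum N (λ I → K₁ + k * cutRow I)
          ≡⟨ trans (Sum-+ N (λ _ → K₁) _) (cong₂ _+_ (Sum-const N K₁) (Sum-scale N k cutRow)) ⟩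
        N * K₁ + k * Sum N cutRow                                        ≤⟨ +-monoʳ-≤ (N * K₁) (*-monoʳ-≤ k (Sum-mono N (λ I _ → cut-row-bound I))) ⟩
        N * K₁ + k * Sum N (λ I → 2 * k * count N (blocks I) + t * count N (λ J → heavy I J))
          ≡⟨ cong (λ x → N * K₁ + k * x) (trans (Sum-+ N _ _) (cong₂ _+_ (Sum-scale N (2 * k) _) (Sum-scale N t _))) ⟩
        N * K₁ + k * (2 * k * ones N blocks + t * Sum N (λ I → count N (λ J → heavy I J)))
          ≤⟨ +-monoʳ-≤ (N * K₁) (*-monoʳ-≤ k (+-monoʳ-≤ (2 * k * ones N blocks) (*-monoʳ-≤ t heavy-total))) ⟩
        N * K₁ + k * (2 * k * ones N blocks + t * (N * (2 ^ t * k)))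
          ≡⟨ solve 6 (λ N K₁ k c t P → N :* K₁ :+ k :* (con 2 :* k :* c :+ t :* (N :* P)) := k :* (con 2 :* k) :* c :+ N :* (K₁ :+ k :* (t :* P)))
                   refl N K₁ k (ones N blocks) t (2 ^ t * k) ⟩
        k * (2 * k) * ones N blocks + N * stepConstant t                  ∎
      where
        open ≤-Reasoning
        K₁ : ℕ
        K₁ = t * t + t * (2 ^ t * (2 * k)) + t
        heavy-total : Sum N (λ I → count N (λ J → heavy I J)) ≤ N * (2 ^ t * k)
        heavy-total = begin
          Sum N (λ I → count N (λ J → heavy I J))   ≡⟨ Sum-swap N N (λ I J → ind (heavy I J)) ⟩
          Sum N (λ J → count N (λ I → heavy I J))   ≤⟨ Sum-bound N _ (λ J _ → heavy-bound avoid N J) ⟩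
          N * (2 ^ t * k)                           ∎

  A : ℕ
  A = k * (2 * k)

  -- the block size: large enough that a compression step contracts
  t₀ : ℕ
  t₀ = 4 + 4 * A

  K : ℕ
  K = stepConstant t₀

  C : ℕ
  C = K + t₀

  small-bound : ∀ n h → n < t₀ → ones n h ≤ C * n
  small-bound n h n<t₀ = begin
      ones n h  ≤⟨ Sum-bound n n (λ r _ → count≤ n (h r)) ⟩
      n * n     ≤⟨ *-monoˡ-≤ n (<⇒≤ n<t₀) ⟩
      t₀ * n    ≤⟨ *-monoˡ-≤ n (m≤n+m t₀ K) ⟩
      C * n     ∎
    where open ≤-Reasoning

  -- with N·t₀ ≤ 2n, the step bound A·(C·N) + N·K stays below C·n
  contraction : (A * C + K) + (A * C + K) ≤ C * t₀
  contraction = begin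
      (A * C + K) + (A * C + K)                             ≤⟨ +-mono-≤ (+-monoʳ-≤ (A * C) K≤C) (+-monoʳ-≤ (A * C) K≤C) ⟩
      (A * C + C) + (A * C + C)                             ≤⟨ m≤m+n _ _ ⟩
      (A * C + C) + (A * C + C) + ((A * C + C) + (A * C + C))
        ≡⟨ solve 2 (λ A C → (A :* C :+ C) :+ (A :* C :+ C) :+ ((A :* C :+ C) :+ (A :* C :+ C)) := C :* (con 4 :+ con 4 :* A)) refl A C ⟩
      C * t₀                                                ∎
    where
      open ≤-Reasoning
      K≤C : K ≤ C
      K≤C = m≤m+n K t₀

  -- Strong induction on the number of rows, through a bound b ≥ n.
  ones-bound-below : ∀ b n h → n ≤ b → UpperTriangular n h → ¬ Copy h suc → ones n h ≤ C * n
  ones-bound-below b n h n≤b upper avoid with t₀ ≤? n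
  ... | no  t₀≰n = small-bound n h (≰⇒> t₀≰n)
  ones-bound-below zero    n h n≤0 upper avoid | yes t₀≤n = ⊥-elim (<⇒≱ (≤-trans (s≤s z≤n) t₀≤n) n≤0)
  ones-bound-below (suc b) n h n≤b upper avoid | yes t₀≤n = compress (coarsen t₀ n (s≤s (s≤s (s≤s (s≤s z≤n)))) t₀≤n)
    where
      compress : Coarsening t₀ n → ones n h ≤ C * n
      compress coarse = *-cancelʳ-≤ (ones n h) (C * n) t₀ (begin
          ones n h * t₀                      ≤⟨ *-monoˡ-≤ t₀ (≤-trans step (+-monoˡ-≤ (N * K) (*-monoʳ-≤ A ih))) ⟩
          (A * (C * N) + N * K) * t₀         ≡⟨ solve 5 (λ A C N K t → (A :* (C :* N) :+ N :* K) :* t := (A :* C :+ K) :* (N :* t)) refl A C N K t₀ ⟩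
          (A * C + K) * (N * t₀)             ≤⟨ *-monoʳ-≤ (A * C + K) Nt≤2n ⟩
          (A * C + K) * (n + n)              ≡⟨ solve 2 (λ X n → X :* (n :+ n) := (X :+ X) :* n) refl (A * C + K) n ⟩
          ((A * C + K) + (A * C + K)) * n    ≤⟨ *-monoˡ-≤ n contraction ⟩
          C * t₀ * n                         ≡⟨ solve 3 (λ C t n → C :* t :* n := C :* n :* t) refl C t₀ n ⟩
          C * n * t₀                         ∎)
        where
          open ≤-Reasoning
          open Coarsening coarse
          open Compression t₀ h using (blocks; lift-cuts; lift-blocks; blocks-upper)
          ih : ones N blocks ≤ C * N
          ih = ones-bound-below b N blocks (s≤s⁻¹ (<-≤-trans N<n n≤b)) (blocks-upper upper n≤Nt)
                 (λ copy → avoid (lift-cuts (lift-blocks copy)))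
          step : ones n h ≤ A * ones N blocks + N * K
          step = Step.step-bound t₀ h n N upper avoid n≤Nt

  ones-bound : ∀ n h → UpperTriangular n h → ¬ Copy h suc → ones n h ≤ C * n
  ones-bound n h = ones-bound-below n n h ≤-refl

theorem3p1 : (k : ℕ) → k ≥ 1 → (π : Permutation′ k) →
    Σ ℕ λ C → ∀ (n : ℕ) (G : OrderedGraph n) →
      Avoids G (twoTupleMatching k π) → edgeCount G ≤ C * n
theorem3p1 k k≥1 π = C , bound
  where
    open Counting k k≥1 π using (C; ones-bound)
    open Pattern k π using (module Embedding)
    bound : ∀ n (G : OrderedGraph n) → Avoids G (twoTupleMatching k π) → edgeCount G ≤ C * n
    bound n G avoids = begin
        edgeCount G             ≡⟨ edgeCount-ones G ⟩
        ones n (adjMatrix G)    ≤⟨ ones-bound n (adjMatrix G) (adjMatrix-upper G) (λ copy → avoids (Embedding.contains G copy)) ⟩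
        C * n                   ∎
      where open ≤-Reasoning
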